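{- Let $(\mathcal{M},w)$ be a pointed $\Theta$-model with $\mathcal{M}=\langle W,\prec,V\rangle$, let $k>0$, and let $\alpha_1,\dots,\alpha_k\in W^{un}_w$ be pairwise distinct with $\alpha_i\mathrel{\rho^{un}_w}\alpha_{i+1}$ for all $i<k$. Then there exist $m,n\ge0$ and (not necessarily pairwise distinct) $v_1,\dots,v_m\in W$ and $u_1,\dots,u_n\in W$ such that: (1) $v_m\prec\dots\prec v_1\prec end(\alpha_{m+1})\prec u_1\prec\dots\prec u_n$; (2) $k=m+n+1$; (3) for all $1\le i\le m$, $\alpha_i=(\alpha_{m+1})^\frown(v_1,\dots,v_{m-i+1})$; (4) for all $1\le i\le n$, $\alpha_{m+1+i}=(\alpha_{m+1})^\frown(u_1,\dots,u_i)$.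
   Context: A $\Theta$-model is $\mathcal{M}=\langle W,\prec,V\rangle$, $W\ne\varnothing$, $\prec$ a partial order, $V$ a monotone valuation of the letters in $\Theta$; $(\mathcal{M},w)$ is pointed if $w\in W$. $W^{un}_w$ is the set of finite sequences $(u_1,\dots,u_n)$, $n\ge1$, of elements of $W$ with $u_1=w$ and, for all $i<n$, $u_i\ne u_{i+1}$ and ($u_i\prec u_{i+1}$ or $u_{i+1}\prec u_i$). The relation $\rho^{un}_w$ on $W^{un}_w$ consists of the pairs $(s,t)$ such that for some $n\ge1$ and $(w_1,\dots,w_{n+1})$, either $s=(w_1,\dots,w_n)$, $t=(w_1,\dots,w_{n+1})$ and $w_n\prec w_{n+1}$, or $s=(w_1,\dots,w_{n+1})$, $t=(w_1,\dots,w_n)$ and $w_{n+1}\prec w_n$. $end(\alpha)$ is the last element of the sequence $\alpha$, $^\frown$ is concatenation, and the empty tuple is the case $m=0$ or $n=0$. -}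

module Defs where

open import Data.List using (List; []; _∷_; _∷ʳ_; last)
open import Data.Maybe using (Maybe)
open import Data.Product using (Σ; _×_; ∃; ∃-syntax)
open import Data.Sum using (_⊎_)
open import Relation.Binary.PropositionalEquality using (_≡_; _≢_)
open import Relation.Binary.Structures using (IsPartialOrder)

-- A Θ-model ⟨W, ≺, V⟩ over a set of letters Θ.
-- W nonempty is guaranteed by a designated point (pointed model).
record Model (Θ : Set) : Set₁ where
  field
    W      : Set
    _≺_    : W → W → Set
    isPO   : IsPartialOrder _≡_ _≺_
    V      : Θ → W → Set
    V-mono : ∀ {p u v} → u ≺ v → V p u → V p v

module _ {Θ : Set} (M : Model Θ) where
  open Model M

  Zigzag : List W → Set
  Zigzag []           = Data.Unit.⊤ where import Data.Unit
  Zigzag (x ∷ [])     = Data.Unit.⊤ where import Data.Unit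
  Zigzag (x ∷ y ∷ xs) = (x ≢ y × (x ≺ y ⊎ y ≺ x)) × Zigzag (y ∷ xs)

  InWun : W → List W → Set
  InWun w []       = Data.Empty.⊥ where import Data.Empty
  InWun w (x ∷ xs) = (x ≡ w) × Zigzag (x ∷ xs)

  ρun : W → List W → List W → Set
  ρun w s t = InWun w s × InWun w t ×
    (∃[ p ] ∃[ y ] ∃[ x ]
       ((s ≡ p ∷ʳ y × t ≡ (p ∷ʳ y) ∷ʳ x × y ≺ x)
      ⊎ (s ≡ (p ∷ʳ y) ∷ʳ x × t ≡ p ∷ʳ y × x ≺ y)))

  end : List W → Maybe W
  end = last

-- Each step pushes a world onto the end of the path or pops its last world, and in either case
-- the two ends involved are ≺-related in the direction recorded by the chain (1). A push
-- immediately followed by a pop returns to the same path, which distinctness forbids; hence all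
-- pops precede all pushes, and the sequence descends to its shortest member α_{m+1}, then climbs.
module Submission where

open import Defs
open import Data.Nat using (ℕ; zero; suc; _+_; _∸_; _≤_; _<_; z≤n; s≤s)
open import Data.Nat.Properties
  using ( +-comm; +-∸-assoc; n∸n≡0; m∸n+n≡m; +-monoʳ-≤; m≤n+m; n≤1+n
        ; ≤-trans; ≤-reflexive; <⇒≢; m≤n⇒m<n∨m≡n )
open import Data.Fin using (fromℕ<)
open import Data.Fin.Properties using (toℕ-fromℕ<)
open import Data.List
  using (List; []; _∷_; _++_; _∷ʳ_; take; reverse; length; last; head; lookup; initLast; _∷ʳ′_)
open import Data.List.Properties
  using (++-assoc; ++-identityʳ; reverse-++; length-++; take-all; take-suc; ∷ʳ-injectiveˡ)
open import Data.List.Relation.Unary.Linked using (Linked; [-]; _∷_; _∷′_)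
open import Data.Maybe using (just)
open import Data.Maybe.Properties using (just-injective)
import Data.Maybe.Relation.Binary.Connected as Connected
open import Data.Product using (_×_; ∃-syntax; _,_; proj₂)
open import Data.Sum using (inj₁; inj₂)
open import Data.Empty using (⊥-elim)
open import Function using (_∘_)
open import Relation.Binary.PropositionalEquality
  using (_≡_; _≢_; refl; sym; trans; cong; subst; module ≡-Reasoning)

module _ {A : Set} where

  last-∷ʳ : (xs : List A) (x : A) → last (xs ∷ʳ x) ≡ just x
  last-∷ʳ []           x = refl
  last-∷ʳ (_ ∷ [])     x = refl
  last-∷ʳ (_ ∷ y ∷ xs) x = last-∷ʳ (y ∷ xs) x

  last-∷ : (x : A) (xs : List A) → ∃[ e ] last (x ∷ xs) ≡ just e
  last-∷ x []       = x , refl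
  last-∷ _ (y ∷ xs) = last-∷ y xs

  take-++-≤ : ∀ n (xs ys : List A) → n ≤ length xs → take n (xs ++ ys) ≡ take n xs
  take-++-≤ zero    _        _  _            = refl
  take-++-≤ (suc n) (x ∷ xs) ys (s≤s n≤∣xs∣) = cong (x ∷_) (take-++-≤ n xs ys n≤∣xs∣)

  take-suc-∷ʳ : ∀ {n} {xs : List A} → suc n ≤ length xs →
                ∃[ z ] take (suc n) xs ≡ take n xs ∷ʳ z
  take-suc-∷ʳ {n} {xs} n<∣xs∣ = lookup xs i , subst P (toℕ-fromℕ< n<∣xs∣) (take-suc xs i)
    where
    i = fromℕ< n<∣xs∣
    P = λ j → take (suc j) xs ≡ take j xs ∷ʳ lookup xs i

  head-reverse-++ : ∀ {e} (c vs us : List A) → last c ≡ just e →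
                    head (reverse vs ++ e ∷ us) ≡ last (c ++ vs)
  head-reverse-++ c vs us last-c with initLast vs
  ... | []       = trans (sym last-c) (cong last (sym (++-identityʳ c)))
  ... | ini ∷ʳ′ v = begin
    head (reverse (ini ∷ʳ v) ++ _) ≡⟨ cong (λ l → head (l ++ _)) (reverse-++ ini (v ∷ [])) ⟩
    just v                         ≡⟨ sym (last-∷ʳ (c ++ ini) v) ⟩
    last ((c ++ ini) ∷ʳ v)         ≡⟨ cong last (++-assoc c ini (v ∷ [])) ⟩
    last (c ++ ini ∷ʳ v)           ∎
    where open ≡-Reasoning

  data Step (R : A → A → Set) (s t : List A) : Set where
    extend  : ∀ {x y} → last s ≡ just y → R y x → t ≡ s ∷ʳ x → Step R s t
    retract : ∀ {x y} → last t ≡ just y → R x y → s ≡ t ∷ʳ x → Step R s t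

  last-target : ∀ {R s t} → Step R s t → ∃[ y ] last t ≡ just y
  last-target {s = s} (extend {x} _ _ t≡s∷ʳx) = x , trans (cong last t≡s∷ʳx) (last-∷ʳ s x)
  last-target (retract last-t _ _)            = _ , last-t

  record Valley (R : A → A → Set) (α : ℕ → List A) (k : ℕ) : Set where
    field
      m n        : ℕ
      vs us      : List A
      e          : A
      length-vs  : length vs ≡ m
      length-us  : length us ≡ n
      last-pivot : last (α (suc m)) ≡ just e
      chain      : Linked R (reverse vs ++ e ∷ us)
      size       : k ≡ m + n + 1
      descent    : ∀ i → 1 ≤ i → i ≤ m → α i ≡ α (suc m) ++ take (m ∸ i + 1) vs
      ascent     : ∀ i → 1 ≤ i → i ≤ n → α (suc m + i) ≡ α (suc m) ++ take i us

  module _ {R : A → A → Set} {α : ℕ → List A} {k : ℕ} (V : Valley R α k) where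
    open Valley V

    pivot++take : ℕ → List A
    pivot++take j = α (suc m) ++ take j vs

    descent⁺ : ∀ i → 1 ≤ i → i ≤ suc m → α i ≡ α (suc m) ++ take (suc m ∸ i) vs
    descent⁺ i 1≤i i≤1+m with m≤n⇒m<n∨m≡n i≤1+m
    ... | inj₁ (s≤s i≤m) = trans (descent i 1≤i i≤m) (cong pivot++take m∸i+1≡1+m∸i)
      where m∸i+1≡1+m∸i = trans (+-comm (m ∸ i) 1) (sym (+-∸-assoc 1 i≤m))
    ... | inj₂ refl      = sym (trans (cong pivot++take (n∸n≡0 m)) (++-identityʳ _))

    first≡pivot++vs : α 1 ≡ α (suc m) ++ vs
    first≡pivot++vs = trans (descent⁺ 1 (s≤s z≤n) (s≤s z≤n))
                            (cong (α (suc m) ++_) (take-all m vs (≤-reflexive length-vs)))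

    head-chain≡last-first : head (reverse vs ++ e ∷ us) ≡ last (α 1)
    head-chain≡last-first = trans (head-reverse-++ (α (suc m)) vs us last-pivot)
                                  (cong last (sym first≡pivot++vs))

  descending⇒retracts : ∀ {R α k} (V : Valley R α k) → 1 ≤ Valley.m V → ∃[ z ] α 1 ≡ α 2 ∷ʳ z
  descending⇒retracts {α = α} V@record { m = suc t ; vs = vs ; length-vs = length-vs } _
    with take-suc-∷ʳ {n = t} {xs = vs} (≤-reflexive (sym length-vs))
  ... | z , take-suc-t = z , (begin
    α 1                      ≡⟨ descent⁺ V 1 (s≤s z≤n) (s≤s z≤n) ⟩
    c ++ take (suc t) vs     ≡⟨ cong (c ++_) take-suc-t ⟩
    c ++ (take t vs ∷ʳ z)    ≡⟨ sym (++-assoc c (take t vs) (z ∷ [])) ⟩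
    (c ++ take t vs) ∷ʳ z    ≡⟨ cong (_∷ʳ z) (sym (descent⁺ V 2 (s≤s z≤n) (s≤s (s≤s z≤n)))) ⟩
    α 2 ∷ʳ z                 ∎)
    where
    open ≡-Reasoning
    c = α (suc (suc t))

  module _ {R : A → A → Set} {α : ℕ → List A} {k : ℕ} where

    retract-step : ∀ {x y} → Valley R (α ∘ suc) k →
                   last (α 2) ≡ just y → R x y → α 1 ≡ α 2 ∷ʳ x → Valley R α (suc k)
    retract-step {x} {y} V last-α₂ Rxy α₁≡α₂∷ʳx = record
      { m          = suc m
      ; n          = n
      ; vs         = vs ∷ʳ x
      ; us         = us
      ; e          = e
      ; length-vs  = trans length-vs∷ʳx (+-comm m 1)
      ; length-us  = length-us
      ; last-pivot = last-pivot
      ; chain      = subst (λ l → Linked R (l ++ e ∷ us)) (sym (reverse-++ vs (x ∷ [])))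
                           (x-connected ∷′ chain)
      ; size       = cong suc size
      ; descent    = descent′
      ; ascent     = ascent
      }
      where
      open Valley V
      c = α (suc (suc m))

      length-vs∷ʳx : length (vs ∷ʳ x) ≡ m + 1
      length-vs∷ʳx = trans (length-++ vs) (cong (_+ 1) length-vs)

      x-connected : Connected.Connected R (just x) (head (reverse vs ++ e ∷ us))
      x-connected = subst (Connected.Connected R (just x))
                          (sym (trans (head-chain≡last-first V) last-α₂)) (Connected.just Rxy)

      descent′ : ∀ i → 1 ≤ i → i ≤ suc m → α i ≡ c ++ take (suc m ∸ i + 1) (vs ∷ʳ x)
      descent′ (suc zero) _ _ = begin
        α 1                          ≡⟨ α₁≡α₂∷ʳx ⟩
        α 2 ∷ʳ x                     ≡⟨ cong (_∷ʳ x) (first≡pivot++vs V) ⟩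
        (c ++ vs) ∷ʳ x               ≡⟨ ++-assoc c vs (x ∷ []) ⟩
        c ++ vs ∷ʳ x                 ≡⟨ cong (c ++_) (sym (take-all (m + 1) (vs ∷ʳ x) ∣vs∷ʳx∣≤m+1)) ⟩
        c ++ take (m + 1) (vs ∷ʳ x)  ∎
        where
        open ≡-Reasoning
        ∣vs∷ʳx∣≤m+1 = ≤-reflexive length-vs∷ʳx
      descent′ (suc (suc i)) _ (s≤s 1+i≤m) =
        trans (descent (suc i) (s≤s z≤n) 1+i≤m)
              (cong (c ++_) (sym (take-++-≤ (m ∸ suc i + 1) vs (x ∷ []) bound)))
        where
        bound : m ∸ suc i + 1 ≤ length vs
        bound = ≤-trans (+-monoʳ-≤ (m ∸ suc i) (s≤s z≤n))
                        (≤-reflexive (trans (m∸n+n≡m 1+i≤m) (sym length-vs)))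

    extend-step : ∀ {x y} → Valley R (α ∘ suc) k → (2 ≤ k → α 1 ≢ α 3) →
                  last (α 1) ≡ just y → R y x → α 2 ≡ α 1 ∷ʳ x → Valley R α (suc k)
    extend-step {x} {y} record { m = zero ; n = n ; vs = [] ; us = us ; e = e
                               ; length-us = length-us ; last-pivot = last-α₂ ; chain = chain
                               ; size = size ; ascent = ascent }
                _ last-α₁ Ryx α₂≡α₁∷ʳx = record
      { m          = 0
      ; n          = suc n
      ; vs         = []
      ; us         = x ∷ us
      ; e          = y
      ; length-vs  = refl
      ; length-us  = cong suc length-us
      ; last-pivot = last-α₁
      ; chain      = Ryx ∷ subst (λ z → Linked R (z ∷ us)) e≡x chain
      ; size       = cong suc size
      ; descent    = λ { _ (s≤s _) () }
      ; ascent     = ascent′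
      }
      where
      e≡x : e ≡ x
      e≡x = just-injective (trans (sym last-α₂) (trans (cong last α₂≡α₁∷ʳx) (last-∷ʳ (α 1) x)))

      ascent′ : ∀ i → 1 ≤ i → i ≤ suc n → α (suc i) ≡ α 1 ++ take i (x ∷ us)
      ascent′ (suc zero)    _ _          = α₂≡α₁∷ʳx
      ascent′ (suc (suc i)) _ (s≤s i<n) =
        trans (ascent (suc i) (s≤s z≤n) i<n)
              (trans (cong (_++ _) α₂≡α₁∷ʳx) (++-assoc (α 1) (x ∷ []) _))
    extend-step V@record { m = suc t ; n = n ; size = size } no-return _ _ α₂≡α₁∷ʳx =
      ⊥-elim (no-return 2≤k (∷ʳ-injectiveˡ (α 1) (α 3) (trans (sym α₂≡α₁∷ʳx) α₂≡α₃∷ʳz)))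
      where
      α₂≡α₃∷ʳz = proj₂ (descending⇒retracts V (s≤s z≤n))
      2≤k : 2 ≤ k
      2≤k = subst (2 ≤_) (sym size) (s≤s (m≤n+m 1 (t + n)))

  valley : ∀ {R} k (α : ℕ → List A) → ∃[ e ] last (α 1) ≡ just e →
           (∀ i → i < k → Step R (α (suc i)) (α (2 + i))) →
           (∀ i → 2 + i ≤ k → α (suc i) ≢ α (3 + i)) →
           Valley R α (suc k)
  valley zero α (e , last-α₁) _ _ = record
    { m = 0 ; n = 0 ; vs = [] ; us = [] ; e = e ; length-vs = refl ; length-us = refl
    ; last-pivot = last-α₁ ; chain = [-] ; size = refl
    ; descent = λ { _ (s≤s _) () } ; ascent = λ { _ (s≤s _) () } }
  valley {R} (suc k) α _ steps no-return = from-first-step (steps 0 (s≤s z≤n))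
    where
    V : Valley R (α ∘ suc) (suc k)
    V = valley k (α ∘ suc) (last-target (steps 0 (s≤s z≤n)))
               (λ i → steps (suc i) ∘ s≤s) (λ i → no-return (suc i) ∘ s≤s)

    from-first-step : Step R (α 1) (α 2) → Valley R α (suc (suc k))
    from-first-step (extend last-α₁ Ryx α₂≡α₁∷ʳx) = extend-step V (no-return 0) last-α₁ Ryx α₂≡α₁∷ʳx
    from-first-step (retract last-α₂ Rxy α₁≡α₂∷ʳx) = retract-step V last-α₂ Rxy α₁≡α₂∷ʳx

module _ {Θ : Set} (M : Model Θ) (w : Model.W M) where
  open Model M

  InWun⇒last : ∀ {s} → InWun M w s → ∃[ e ] last s ≡ just e
  InWun⇒last {x ∷ xs} _ = last-∷ x xs

  ρun⇒Step : ∀ {s t} → ρun M w s t → Step _≺_ s t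
  ρun⇒Step (_ , _ , p , y , x , inj₁ (refl , refl , y≺x)) = extend (last-∷ʳ p y) y≺x refl
  ρun⇒Step (_ , _ , p , y , x , inj₂ (refl , refl , x≺y)) = retract (last-∷ʳ p y) x≺y refl

lemma3p3 : {Θ : Set} (M : Model Θ) (w : Model.W M) (k : ℕ) → 0 < k →
    (α : ℕ → List (Model.W M)) →
    (∀ i → 1 ≤ i → i ≤ k → InWun M w (α i)) →
    (∀ i j → 1 ≤ i → i ≤ k → 1 ≤ j → j ≤ k → i ≢ j → α i ≢ α j) →
    (∀ i → 1 ≤ i → i < k → ρun M w (α i) (α (suc i))) →
    ∃[ m ] ∃[ n ] ∃[ vs ] ∃[ us ] ∃[ e ]
      (length vs ≡ m × length us ≡ n ×
       end M (α (suc m)) ≡ just e ×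
       Linked (Model._≺_ M) (reverse vs ++ e ∷ us) ×
       k ≡ m + n + 1 ×
       (∀ i → 1 ≤ i → i ≤ m → α i ≡ α (suc m) ++ take (m ∸ i + 1) vs) ×
       (∀ i → 1 ≤ i → i ≤ n → α (suc m + i) ≡ α (suc m) ++ take i us))
lemma3p3 M w (suc k) _ α inWun distinct ρ =
  m , n , vs , us , e , length-vs , length-us , last-pivot , chain , size , descent , ascent
  where
  steps : ∀ i → i < k → Step (Model._≺_ M) (α (suc i)) (α (2 + i))
  steps i i<k = ρun⇒Step M w (ρ (suc i) (s≤s z≤n) (s≤s i<k))

  no-return : ∀ i → 2 + i ≤ k → α (suc i) ≢ α (3 + i)
  no-return i 2+i≤k =
    distinct (suc i) (3 + i) (s≤s z≤n) (s≤s (≤-trans (m≤n+m i 2) 2+i≤k)) (s≤s z≤n) (s≤s 2+i≤k)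
             (<⇒≢ (s≤s (s≤s (n≤1+n i))))

  open Valley (valley k α (InWun⇒last M w (inWun 1 (s≤s z≤n) (s≤s z≤n))) steps no-return)
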